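{- Let $m=pq$ be the product of two distinct odd primes $p$ and $q$, let $t$ be the multiplicative order of $2$ modulo $m$, and let $\gamma_m\in\mathbb{F}_{2^t}^{*}$ be a primitive $m$-th root of unity. Define the multiset $$\mathcal{Z}=\left\{\frac{z_1+z_2}{z_1z_2+z_2} : z_1,z_2\in\mathbb{F}_{2^t}^{*},\ \mathrm{ord}(z_1)=p,\ \mathrm{ord}(z_2)=q\right\},$$ with one entry for each pair $(z_1,z_2)$. If $\mathcal{Z}$ contains an element of multiplicity greater than one, then $m\in\mathbb{M}_2$.
   Context: The canonical set of $m$ is $S_m=\{s_{11},s_{01},s_{10}\}\subseteq\mathbb{Z}_m$, where $s_{\sigma_1\sigma_2}\in\mathbb{Z}_m$ is the unique residue with $s_{\sigma_1\sigma_2}\equiv\sigma_1 \pmod p$ and $s_{\sigma_1\sigma_2}\equiv\sigma_2\pmod q$ (so $s_{11}=1$). An $S_m$-decoding polynomial is a polynomial $P(X)\in\mathbb{F}_{2^{t}}[X]$ with $P(\gamma_m^{s})=0$ for all $s\in S_m$ and $P(1)=1$. $\mathbb{M}_2$ denotes the set of integers $m=pq$, with $p,q$ distinct odd primes, that yield a $3$-query linear locally decodable code in Efremenko's construction; concretely, $m\in\mathbb{M}_2$ means there exists an $S_m$-decoding polynomial with (at most, equivalently exactly) three monomials. -}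

module Defs where

open import Level using (0ℓ)
open import Data.Nat as ℕ using (ℕ; zero; suc; _%_; _≤_; _<_)
open import Data.Fin using (Fin)
open import Data.Nat.Divisibility using (_∣_)
open import Data.Product using (_×_; _,_; ∃; ∃-syntax)
open import Data.Sum using (_⊎_)
open import Data.Vec using (Vec; foldr)
open import Relation.Binary.PropositionalEquality using (_≡_; _≢_)
open import Relation.Nullary using (¬_)
open import Function.Bundles using (_↔_)
open import Algebra.Structures using (IsCommutativeRing)

-- multiplicative order of a natural number a modulo m (m > 1)
-- (a^t ≡ 1 mod m written as m ∣ a^t ∸ 1; here a ≥ 1 so a^t ≥ 1)
IsOrderMod : ℕ → ℕ → ℕ → Set
IsOrderMod a m t =
  1 ≤ t × m ∣ (a ℕ.^ t) ℕ.∸ 1 × (∀ s → 1 ≤ s → s < t → ¬ (m ∣ (a ℕ.^ s) ℕ.∸ 1))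

record FiniteField (t : ℕ) : Set₁ where
  infixl 6 _+_
  infixl 7 _*_
  field
    Carrier : Set
    _+_ _*_ : Carrier → Carrier → Carrier
    -_      : Carrier → Carrier
    0# 1#   : Carrier
    _⁻¹     : Carrier → Carrier
    isCommutativeRing : IsCommutativeRing _≡_ _+_ _*_ -_ 0# 1#
    0≢1     : 0# ≢ 1#
    ⁻¹-inverse : ∀ x → x ≢ 0# → x * (x ⁻¹) ≡ 1#
    card    : Carrier ↔ Fin (2 ℕ.^ t)

  _^_ : Carrier → ℕ → Carrier
  x ^ zero  = 1#
  x ^ suc n = x * (x ^ n)

  HasOrder : Carrier → ℕ → Set
  HasOrder z n = 1 ≤ n × z ^ n ≡ 1# × (∀ k → 1 ≤ k → k < n → z ^ k ≢ 1#)

  NonZero : Carrier → Set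
  NonZero z = z ≢ 0#

  -- a polynomial with at most three monomials c X^e, given as 3 (coefficient, exponent) pairs
  -- (zero coefficients / repeated exponents allowed, giving "at most three")
  Poly3 : Set
  Poly3 = Vec (Carrier × ℕ) 3

  eval : Poly3 → Carrier → Carrier
  eval P x = foldr _ (λ { (c , e) acc → c * (x ^ e) + acc }) 0# P

  -- s ∈ Z_m (represented by 0 ≤ s < m) lies in the canonical set S_m = {s11, s01, s10},
  -- s_{σ1σ2} ≡ σ1 (mod p), ≡ σ2 (mod q)
  InCanonicalSet : (p q s : ℕ) → .{{_ : ℕ.NonZero p}} → .{{_ : ℕ.NonZero q}} → Set
  InCanonicalSet p q s =
      (s % p ≡ 1 % p × s % q ≡ 1 % q)
    ⊎ (s % p ≡ 0 × s % q ≡ 1 % q)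
    ⊎ (s % p ≡ 1 % p × s % q ≡ 0)

  IsDecodingPoly : (p q : ℕ) → .{{_ : ℕ.NonZero p}} → .{{_ : ℕ.NonZero q}} →
                   (γ : Carrier) → Poly3 → Set
  IsDecodingPoly p q γ P =
    (∀ s → s < p ℕ.* q → InCanonicalSet p q s → eval P (γ ^ s) ≡ 0#) × eval P 1# ≡ 1#

  InM₂ : (p q : ℕ) → .{{_ : ℕ.NonZero p}} → .{{_ : ℕ.NonZero q}} → (γ : Carrier) → Set
  InM₂ p q γ = ∃[ P ] IsDecodingPoly p q γ P

  zval : Carrier → Carrier → Carrier
  zval z₁ z₂ = (z₁ + z₂) * ((z₁ * z₂ + z₂) ⁻¹)

  ZIndex : ℕ → ℕ → Carrier × Carrier → Set
  ZIndex p q (z₁ , z₂) = NonZero z₁ × NonZero z₂ × HasOrder z₁ p × HasOrder z₂ q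

  ZHasRepeat : ℕ → ℕ → Set
  ZHasRepeat p q = ∃[ a ] ∃[ b ]
    (ZIndex p q a × ZIndex p q b × a ≢ b ×
     zval (Data.Product.proj₁ a) (Data.Product.proj₂ a) ≡ zval (Data.Product.proj₁ b) (Data.Product.proj₂ b))

-- Let (z₁, z₂) ≠ (w₁, w₂) be two index pairs of 𝒵 with the same entry.  The
-- decoding polynomial is the normalisation of the three-term relation
--
--     Λ(X, Y) = (z₂ w₁ + z₁ w₂) + (w₁ + w₂) X + (z₁ + z₂) Y,
--
-- evaluated at X = x^e₁, Y = x^e₂ where γ^e₁ = z₁ z₂ and γ^e₂ = w₁ w₂.  At
-- x = γ^s with s ∈ S_m the pair (X, Y) is (z₁ z₂, w₁ w₂), (z₂, w₂) or (z₁, w₁);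
-- Λ vanishes at the last two identically (in characteristic two) and at the
-- first exactly because the two entries of 𝒵 agree.  The value Λ(1, 1) is
-- nonzero because the pairs are distinct, so dividing by it gives P(1) = 1.

module Submission where

open import Defs
open import Level using (0ℓ)
open import Data.Nat as ℕ using (ℕ; zero; suc; _%_; NonZero; z≤n; s≤s)
open import Data.Nat.Primality using (Prime; prime⇒irreducible; prime⇒nonTrivial)
open import Data.Nat.Divisibility using (m%n≡0⇒n∣m)
import Data.Nat.Properties as ℕP
import Data.Nat.DivMod as ℕD
open import Data.Fin as Fin using (Fin; toℕ)
open import Data.Fin.Properties using (any?; toℕ<n)
import Data.Fin.Permutation as Perm
open import Data.Product using (_×_; _,_; ∃; proj₁; proj₂; uncurry)
open import Data.Sum using (inj₁; inj₂; [_,_])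
open import Data.Vec using (_∷_; [])
open import Data.Empty using (⊥-elim)
open import Function.Base using (_∘_)
open import Function.Bundles using (Inverse)
open import Relation.Nullary using (Dec; yes; no)
open import Relation.Binary.PropositionalEquality
  using (_≡_; _≢_; refl; sym; trans; cong; cong₂; subst; module ≡-Reasoning)
open import Algebra.Bundles using (CommutativeRing)

module FieldTheory {t : ℕ} (F : FiniteField t) where
  open FiniteField F hiding (NonZero)

  commutativeRing : CommutativeRing 0ℓ 0ℓ
  commutativeRing = record { isCommutativeRing = isCommutativeRing }

  open CommutativeRing commutativeRing
    using (+-assoc; +-identityˡ; +-identityʳ; -‿inverseˡ; -‿inverseʳ;
           *-comm; *-assoc; *-identityˡ; *-identityʳ; zeroʳ;
           semiring; commutativeSemiring; +-group)
  open import Algebra.Solver.Ring.NaturalCoefficients.Default commutativeSemiring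
  import Algebra.Properties.CommutativeSemiring.Exp commutativeSemiring as Exp
  import Algebra.Properties.Semiring.Sum semiring as Σ
  import Algebra.Properties.Semiring.Mult semiring as Mult
  open Σ using (sum; sum-cong-≗; sum-replicate; sum-replicate-zero; ∑-distrib-+; ∑-comm; sum-permute; *-distribˡ-sum)
  open import Algebra.Properties.Group +-group using (∙-cancelˡ; ∙-cancelʳ)
  open Mult using () renaming (_×_ to _·_)
  open ≡-Reasoning
  open Inverse card using (to; from; strictlyInverseˡ; strictlyInverseʳ)

  infix 4 _≟_
  _≟_ : (x y : Carrier) → Dec (x ≡ y)
  x ≟ y with to x Fin.≟ to y
  ... | yes e = yes (begin
    x              ≡⟨ strictlyInverseʳ x ⟨
    from (to x)    ≡⟨ cong from e ⟩
    from (to y)    ≡⟨ strictlyInverseʳ y ⟩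
    y              ∎)
  ... | no ne = no (λ e → ne (cong to e))

  *-cancelˡ : ∀ {x y z} → x ≢ 0# → x * y ≡ x * z → y ≡ z
  *-cancelˡ {x} {y} {z} x≢0 e = begin
    y                ≡⟨ *-identityˡ y ⟨
    1# * y           ≡⟨ cong (_* y) (trans (*-comm _ _) (⁻¹-inverse x x≢0)) ⟨
    (x ⁻¹ * x) * y   ≡⟨ *-assoc _ _ _ ⟩
    x ⁻¹ * (x * y)   ≡⟨ cong (x ⁻¹ *_) e ⟩
    x ⁻¹ * (x * z)   ≡⟨ *-assoc _ _ _ ⟨
    (x ⁻¹ * x) * z   ≡⟨ cong (_* z) (trans (*-comm _ _) (⁻¹-inverse x x≢0)) ⟩
    1# * z           ≡⟨ *-identityˡ z ⟩
    z                ∎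

  no-zero-divisors : ∀ {x y} → x ≢ 0# → x * y ≡ 0# → y ≡ 0#
  no-zero-divisors {x} x≢0 e = *-cancelˡ x≢0 (trans e (sym (zeroʳ x)))

  *-≢0 : ∀ {x y} → x ≢ 0# → y ≢ 0# → x * y ≢ 0#
  *-≢0 x≢0 y≢0 e = y≢0 (no-zero-divisors x≢0 e)

  cross-multiply : ∀ {x y z w} → y ≢ 0# → w ≢ 0# →
                   x * y ⁻¹ ≡ z * w ⁻¹ → x * w ≡ z * y
  cross-multiply {x} {y} {z} {w} y≢0 w≢0 e = begin
    x * w                      ≡⟨ solve 2 (λ x w → x :* w := x :* con 1 :* w) refl x w ⟩
    x * 1# * w                 ≡⟨ cong (λ u → x * u * w) (⁻¹-inverse y y≢0) ⟨
    x * (y * y ⁻¹) * w         ≡⟨ solve 4 (λ x y i w → x :* (y :* i) :* w := (x :* i) :* (y :* w)) refl x y (y ⁻¹) w ⟩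
    (x * y ⁻¹) * (y * w)       ≡⟨ cong (_* (y * w)) e ⟩
    (z * w ⁻¹) * (y * w)       ≡⟨ solve 4 (λ z i y w → (z :* i) :* (y :* w) := z :* y :* (w :* i)) refl z (w ⁻¹) y w ⟩
    z * y * (w * w ⁻¹)         ≡⟨ cong (z * y *_) (⁻¹-inverse w w≢0) ⟩
    z * y * 1#                 ≡⟨ *-identityʳ _ ⟩
    z * y                      ∎

  ^-agrees : ∀ x n → x ^ n ≡ x Exp.^ n
  ^-agrees x zero    = refl
  ^-agrees x (suc n) = cong (x *_) (^-agrees x n)

  ^-+ : ∀ x m n → x ^ (m ℕ.+ n) ≡ x ^ m * x ^ n
  ^-+ x m n = begin
    x ^ (m ℕ.+ n)          ≡⟨ ^-agrees x (m ℕ.+ n) ⟩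
    x Exp.^ (m ℕ.+ n)      ≡⟨ Exp.^-homo-* x m n ⟩
    x Exp.^ m * x Exp.^ n  ≡⟨ cong₂ _*_ (^-agrees x m) (^-agrees x n) ⟨
    x ^ m * x ^ n          ∎

  ^-* : ∀ x m n → x ^ (m ℕ.* n) ≡ (x ^ m) ^ n
  ^-* x m n = begin
    x ^ (m ℕ.* n)          ≡⟨ ^-agrees x (m ℕ.* n) ⟩
    x Exp.^ (m ℕ.* n)      ≡⟨ Exp.^-assocʳ x m n ⟨
    (x Exp.^ m) Exp.^ n    ≡⟨ cong (Exp._^ n) (^-agrees x m) ⟨
    (x ^ m) Exp.^ n        ≡⟨ ^-agrees (x ^ m) n ⟨
    (x ^ m) ^ n            ∎

  *-^ : ∀ x y n → (x * y) ^ n ≡ x ^ n * y ^ n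
  *-^ x y n = begin
    (x * y) ^ n            ≡⟨ ^-agrees (x * y) n ⟩
    (x * y) Exp.^ n        ≡⟨ Exp.^-distrib-* x y n ⟩
    x Exp.^ n * y Exp.^ n  ≡⟨ cong₂ _*_ (^-agrees x n) (^-agrees y n) ⟨
    x ^ n * y ^ n          ∎

  1^ : ∀ n → 1# ^ n ≡ 1#
  1^ zero    = refl
  1^ (suc n) = trans (*-identityˡ _) (1^ n)

  ^-≢0 : ∀ {x} → x ≢ 0# → ∀ n → x ^ n ≢ 0#
  ^-≢0 x≢0 zero    = λ e → 0≢1 (sym e)
  ^-≢0 x≢0 (suc n) = *-≢0 x≢0 (^-≢0 x≢0 n)

  ^-mod : ∀ x p .{{_ : NonZero p}} s → x ^ p ≡ 1# → x ^ s ≡ x ^ (s % p)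
  ^-mod x p s xᵖ≡1 = begin
    x ^ s                                 ≡⟨ cong (x ^_) (ℕD.m≡m%n+[m/n]*n s p) ⟩
    x ^ (s % p ℕ.+ (s ℕ./ p) ℕ.* p)       ≡⟨ ^-+ x (s % p) _ ⟩
    x ^ (s % p) * x ^ ((s ℕ./ p) ℕ.* p)   ≡⟨ cong (λ k → x ^ (s % p) * x ^ k) (ℕP.*-comm (s ℕ./ p) p) ⟩
    x ^ (s % p) * x ^ (p ℕ.* (s ℕ./ p))   ≡⟨ cong (x ^ (s % p) *_) (^-* x p (s ℕ./ p)) ⟩
    x ^ (s % p) * (x ^ p) ^ (s ℕ./ p)     ≡⟨ cong (λ u → x ^ (s % p) * u ^ (s ℕ./ p)) xᵖ≡1 ⟩
    x ^ (s % p) * 1# ^ (s ℕ./ p)          ≡⟨ cong (x ^ (s % p) *_) (1^ (s ℕ./ p)) ⟩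
    x ^ (s % p) * 1#                      ≡⟨ *-identityʳ _ ⟩
    x ^ (s % p)                           ∎

  translation : Carrier → Perm.Permutation (2 ℕ.^ t) (2 ℕ.^ t)
  translation c = Perm.permutation (shift c) (shift (- c))
                    (shift-undo (- c) c (-‿inverseˡ c)) (shift-undo c (- c) (-‿inverseʳ c))
    where
    shift : Carrier → Fin (2 ℕ.^ t) → Fin (2 ℕ.^ t)
    shift c i = to (from i + c)
    shift-undo : ∀ d c → d + c ≡ 0# → ∀ i → shift c (shift d i) ≡ i
    shift-undo d c d+c≡0 i = begin
      to (from (to (from i + d)) + c)  ≡⟨ cong (λ u → to (u + c)) (strictlyInverseʳ _) ⟩
      to ((from i + d) + c)            ≡⟨ cong to (+-assoc _ _ _) ⟩
      to (from i + (d + c))            ≡⟨ cong (λ u → to (from i + u)) d+c≡0 ⟩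
      to (from i + 0#)                 ≡⟨ cong to (+-identityʳ _) ⟩
      to (from i)                      ≡⟨ strictlyInverseˡ i ⟩
      i                                ∎

  -- The sum of all field elements is invariant under translation by 1#,
  -- so the order of the field annihilates 1#.
  card·1≡0 : (2 ℕ.^ t) · 1# ≡ 0#
  card·1≡0 = ∙-cancelˡ (sum from) _ _ (begin
    sum from + (2 ℕ.^ t) · 1#              ≡⟨ cong (sum from +_) (sum-replicate (2 ℕ.^ t) {1#}) ⟨
    sum from + sum {2 ℕ.^ t} (λ _ → 1#)    ≡⟨ ∑-distrib-+ from (λ _ → 1#) ⟨
    sum (λ i → from i + 1#)                ≡⟨ sum-cong-≗ (λ i → strictlyInverseʳ (from i + 1#)) ⟨
    sum (λ i → from (to (from i + 1#)))    ≡⟨ sum-permute from (translation 1#) ⟨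
    sum from                               ≡⟨ +-identityʳ _ ⟨
    sum from + 0#                          ∎)

  2ᵏ·1 : ∀ k → (2 ℕ.^ k) · 1# ≡ (1# + 1#) ^ k
  2ᵏ·1 zero    = +-identityʳ 1#
  2ᵏ·1 (suc k) = begin
    (2 ℕ.* 2 ℕ.^ k) · 1#               ≡⟨ Mult.×1-homo-* 2 (2 ℕ.^ k) ⟩
    (1# + (1# + 0#)) * (2 ℕ.^ k) · 1#  ≡⟨ cong₂ _*_ (cong (1# +_) (+-identityʳ 1#)) (2ᵏ·1 k) ⟩
    (1# + 1#) * (1# + 1#) ^ k          ∎

  -- F has characteristic two: otherwise (1 + 1)^t = |F| · 1 would vanish.
  char-two : 1# + 1# ≡ 0#
  char-two with (1# + 1#) ≟ 0#
  ... | yes 2≡0 = 2≡0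
  ... | no  2≢0 = ⊥-elim (^-≢0 2≢0 t (trans (sym (2ᵏ·1 t)) card·1≡0))

  mod-two : ∀ {x y} s → x ≡ y + s * (1# + 1#) → x ≡ y
  mod-two {x} {y} s e = begin
    x                  ≡⟨ e ⟩
    y + s * (1# + 1#)  ≡⟨ cong (λ u → y + s * u) char-two ⟩
    y + s * 0#         ≡⟨ cong (y +_) (zeroʳ s) ⟩
    y + 0#             ≡⟨ +-identityʳ y ⟩
    y                  ∎

  x+x≡0 : ∀ x → x + x ≡ 0#
  x+x≡0 x = mod-two x (solve 1 (λ x → x :+ x := con 0 :+ x :* (con 1 :+ con 1)) refl x)

  +≡0⇒≡ : ∀ {x y} → x + y ≡ 0# → x ≡ y
  +≡0⇒≡ {x} {y} x+y≡0 = begin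
    x               ≡⟨ mod-two y (solve 2 (λ x y → (x :+ y) :+ y := x :+ y :* (con 1 :+ con 1)) refl x y) ⟨
    (x + y) + y     ≡⟨ cong (_+ y) x+y≡0 ⟩
    0# + y          ≡⟨ +-identityˡ y ⟩
    y               ∎

  ≢⇒+≢0 : ∀ {x y} → x ≢ y → x + y ≢ 0#
  ≢⇒+≢0 x≢y x+y≡0 = x≢y (+≡0⇒≡ x+y≡0)

  odd·1 : ∀ n → n % 2 ≡ 1 → n · 1# ≡ 1#
  odd·1 (suc zero)    _   = +-identityʳ 1#
  odd·1 (suc (suc n)) odd = begin
    1# + (1# + n · 1#)  ≡⟨ mod-two 1# (solve 1 (λ m → con 1 :+ (con 1 :+ m) := m :+ con 1 :* (con 1 :+ con 1)) refl (n · 1#)) ⟩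
    n · 1#              ≡⟨ odd·1 n odd ⟩
    1#                  ∎

  geometric : ℕ → Carrier → Carrier
  geometric n y = sum {n} (λ j → y ^ toℕ j)

  geometric-suc : ∀ n y → geometric (suc n) y ≡ 1# + y * geometric n y
  geometric-suc n y = cong (1# +_) (sym (*-distribˡ-sum {n} y (λ j → y ^ toℕ j)))

  geometric-telescopes : ∀ n y → y * geometric n y + 1# ≡ geometric n y + y ^ n
  geometric-telescopes zero    y = cong (_+ 1#) (zeroʳ y)
  geometric-telescopes (suc n) y = begin
    y * geometric (suc n) y + 1#        ≡⟨ cong (λ g → y * g + 1#) (geometric-suc n y) ⟩
    y * (1# + y * G) + 1#               ≡⟨ solve 2 (λ y g → y :* (con 1 :+ y :* g) :+ con 1 := y :* (y :* g :+ con 1) :+ con 1) refl y G ⟩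
    y * (y * G + 1#) + 1#               ≡⟨ cong (λ u → y * u + 1#) (geometric-telescopes n y) ⟩
    y * (G + y ^ n) + 1#                ≡⟨ solve 3 (λ y g c → y :* (g :+ c) :+ con 1 := (con 1 :+ y :* g) :+ y :* c) refl y G (y ^ n) ⟩
    (1# + y * G) + y * y ^ n            ≡⟨ cong (_+ y ^ suc n) (geometric-suc n y) ⟨
    geometric (suc n) y + y ^ suc n     ∎
    where G = geometric n y

  geometric-root : ∀ n y → y ^ n ≡ 1# → y ≢ 1# → geometric n y ≡ 0#
  geometric-root n y yⁿ≡1 y≢1 = no-zero-divisors (≢⇒+≢0 y≢1) (begin
    (y + 1#) * G    ≡⟨ solve 2 (λ y g → (y :+ con 1) :* g := y :* g :+ g) refl y G ⟩
    y * G + G       ≡⟨ cong (_+ G) y*G≡G ⟩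
    G + G           ≡⟨ x+x≡0 G ⟩
    0#              ∎)
    where
    G = geometric n y
    y*G≡G : y * G ≡ G
    y*G≡G = ∙-cancelʳ 1# _ _ (trans (geometric-telescopes n y) (cong (G +_) yⁿ≡1))

  geometric-one : ∀ n → geometric n 1# ≡ n · 1#
  geometric-one n = trans (sum-cong-≗ {n} (λ j → 1^ (toℕ j))) (sum-replicate n)

  ^-swap : ∀ a m n → (a ^ m) ^ n ≡ (a ^ n) ^ m
  ^-swap a m n = trans (sym (^-* a m n)) (trans (cong (a ^_) (ℕP.*-comm m n)) (^-* a n m))

  ^-root : ∀ {a p} k → a ^ p ≡ 1# → (a ^ k) ^ p ≡ 1#
  ^-root {a} {p} k aᵖ≡1 = trans (^-swap a k p) (trans (cong (_^ k) aᵖ≡1) (1^ k))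

  inverse-as-power : ∀ {x b} n → b ^ suc n ≡ 1# → x * b ≡ 1# → x ≡ b ^ n
  inverse-as-power {x} {b} n bⁿ⁺¹≡1 xb≡1 = begin
    x                  ≡⟨ *-identityʳ x ⟨
    x * 1#             ≡⟨ cong (x *_) bⁿ⁺¹≡1 ⟨
    x * (b * b ^ n)    ≡⟨ *-assoc x b _ ⟨
    (x * b) * b ^ n    ≡⟨ cong (_* b ^ n) xb≡1 ⟩
    1# * b ^ n         ≡⟨ *-identityˡ _ ⟩
    b ^ n              ∎

  -- If a has order p then ∑_{k<p} ∑_{j<p} (x a^k)^j = p · 1 for every x:
  -- exchanging the sums, only j = 0 contributes, since for 0 < j < p the
  -- inner sum is a geometric sum over the nontrivial root a^j.
  double-geometric : ∀ {a p} x → HasOrder a p →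
                     sum {p} (λ k → geometric p (x * a ^ toℕ k)) ≡ p · 1#
  double-geometric {a} {zero}   x _                      = refl
  double-geometric {a} {suc p'} x (_ , aᵖ≡1 , a-minimal) = begin
    ∑ (λ k → ∑ (λ j → (x * a ^ toℕ k) ^ toℕ j))          ≡⟨ ∑-comm {p} {p} (λ k j → (x * a ^ toℕ k) ^ toℕ j) ⟩
    ∑ (λ j → ∑ (λ k → (x * a ^ toℕ k) ^ toℕ j))          ≡⟨ sum-cong-≗ {p} (λ j → sum-cong-≗ {p} (λ k → split j k)) ⟩
    ∑ (λ j → ∑ (λ k → x ^ toℕ j * (a ^ toℕ j) ^ toℕ k))  ≡⟨ sum-cong-≗ {p} (λ j → *-distribˡ-sum {p} (x ^ toℕ j) (λ k → (a ^ toℕ j) ^ toℕ k)) ⟨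
    ∑ (λ j → x ^ toℕ j * geometric p (a ^ toℕ j))        ≡⟨ cong₂ _+_ (*-identityˡ _) higher-terms ⟩
    geometric p 1# + 0#                                  ≡⟨ +-identityʳ _ ⟩
    geometric p 1#                                       ≡⟨ geometric-one p ⟩
    p · 1#                                               ∎
    where
    p = suc p'
    ∑ : (Fin p → Carrier) → Carrier
    ∑ = sum {p}
    split : ∀ (j k : Fin p) → (x * a ^ toℕ k) ^ toℕ j ≡ x ^ toℕ j * (a ^ toℕ j) ^ toℕ k
    split j k = trans (*-^ x _ (toℕ j)) (cong (x ^ toℕ j *_) (^-swap a (toℕ k) (toℕ j)))
    higher-terms : sum (λ (j : Fin p') → x ^ suc (toℕ j) * geometric p (a ^ suc (toℕ j))) ≡ 0#
    higher-terms = trans (sum-cong-≗ {p'} vanishes) (sum-replicate-zero p')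
      where
      vanishes : ∀ j → x ^ suc (toℕ j) * geometric p (a ^ suc (toℕ j)) ≡ 0#
      vanishes j = trans (cong (x ^ suc (toℕ j) *_)
                            (geometric-root p _ (^-root {a} {p} (suc (toℕ j)) aᵖ≡1)
                              (a-minimal (suc (toℕ j)) (s≤s z≤n) (s≤s (toℕ<n j)))))
                         (zeroʳ _)

  -- Cyclicity of the p-th roots of unity (p odd): if a has order p, every x
  -- with x^p = 1 is a power of a.  Otherwise x a^k ≠ 1 for all k < p, every
  -- inner sum of the double geometric sum vanishes, yet the sum is p · 1 = 1.
  roots-are-powers : ∀ {a x p} → HasOrder a p → p % 2 ≡ 1 → x ^ p ≡ 1# → ∃ λ i → x ≡ a ^ i
  roots-are-powers {p = zero} _ () _
  roots-are-powers {a} {x} {suc p'} a-order@(_ , aᵖ≡1 , _) p-odd xᵖ≡1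
    with any? (λ (k : Fin (suc p')) → x * a ^ toℕ k ≟ 1#)
  ... | yes (k , xaᵏ≡1) =
    toℕ k ℕ.* p' , trans (inverse-as-power p' (^-root {a} {suc p'} (toℕ k) aᵖ≡1) xaᵏ≡1)
                         (sym (^-* a (toℕ k) p'))
  ... | no no-inverse = ⊥-elim (0≢1 (begin
    0#                                                        ≡⟨ sum-replicate-zero (suc p') ⟨
    sum {suc p'} (λ _ → 0#)                                   ≡⟨ sum-cong-≗ {suc p'} inner-sums-vanish ⟨
    sum {suc p'} (λ k → geometric (suc p') (x * a ^ toℕ k))   ≡⟨ double-geometric x a-order ⟩
    suc p' · 1#                                               ≡⟨ odd·1 (suc p') p-odd ⟩
    1#                                                        ∎))
    where
    inner-sums-vanish : ∀ k → geometric (suc p') (x * a ^ toℕ k) ≡ 0#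
    inner-sums-vanish k = geometric-root (suc p') _ root (λ xaᵏ≡1 → no-inverse (k , xaᵏ≡1))
      where
      root : (x * a ^ toℕ k) ^ suc p' ≡ 1#
      root = trans (*-^ x _ (suc p'))
                   (trans (cong₂ _*_ xᵖ≡1 (^-root {a} {suc p'} (toℕ k) aᵖ≡1)) (*-identityˡ 1#))

  order-≢1 : ∀ {u p} → HasOrder u p → 1 ℕ.< p → u ≢ 1#
  order-≢1 (_ , _ , minimal) 1<p u≡1 = minimal 1 (s≤s z≤n) 1<p (trans (*-identityʳ _) u≡1)

  power-order : ∀ {g} m n .{{_ : NonZero m}} .{{_ : NonZero n}} →
                HasOrder g (m ℕ.* n) → HasOrder (g ^ n) m
  power-order {g} m n (_ , gᵐⁿ≡1 , minimal) =
      ℕ.>-nonZero⁻¹ m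
    , trans (sym (^-* g n m)) (trans (cong (g ^_) (ℕP.*-comm n m)) gᵐⁿ≡1)
    , λ d 1≤d d<m gⁿᵈ≡1 → minimal (n ℕ.* d) (ℕP.*-mono-≤ (ℕ.>-nonZero⁻¹ n) 1≤d)
                            (subst (n ℕ.* d ℕ.<_) (ℕP.*-comm n m) (ℕP.*-monoʳ-< n d<m))
                            (trans (^-* g n d) gⁿᵈ≡1)

  -- An element of order p > 1 is not a q-th root of unity for a prime q ≠ p:
  -- otherwise the order p would divide q.
  order-excludes-prime : ∀ {u p q} .{{_ : NonZero p}} → HasOrder u p → 1 ℕ.< p →
                         Prime q → p ≢ q → u ^ q ≢ 1#
  order-excludes-prime {u} {p} {q} (_ , uᵖ≡1 , minimal) 1<p q-prime p≢q u^q≡1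
    with q % p ℕ.≟ 0
  ... | yes q%p≡0 = [ (λ p≡1 → ℕP.<⇒≢ 1<p (sym p≡1)) , p≢q ]
                      (prime⇒irreducible q-prime (m%n≡0⇒n∣m q p q%p≡0))
  ... | no  q%p≢0 = minimal (q % p) (ℕP.n≢0⇒n>0 q%p≢0) (ℕD.m%n<n q p)
                      (trans (sym (^-mod u p q uᵖ≡1)) u^q≡1)

  -- With γ of order p q (p, q odd), every product of a p-th and a q-th root
  -- of unity is a power of γ: the two factors are powers of γ^q and γ^p.
  exponent-of-product : ∀ {γ u v} p q .{{_ : NonZero p}} .{{_ : NonZero q}} →
                        HasOrder γ (p ℕ.* q) → p % 2 ≡ 1 → q % 2 ≡ 1 →
                        u ^ p ≡ 1# → v ^ q ≡ 1# → ∃ λ e → γ ^ e ≡ u * v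
  exponent-of-product {γ} {u} {v} p q γ-order p-odd q-odd uᵖ≡1 v^q≡1
    with roots-are-powers (power-order p q γ-order) p-odd uᵖ≡1
       | roots-are-powers (power-order q p (subst (HasOrder γ) (ℕP.*-comm p q) γ-order)) q-odd v^q≡1
  ... | i , u≡γ^qi | j , v≡γ^pj = q ℕ.* i ℕ.+ p ℕ.* j , (begin
    γ ^ (q ℕ.* i ℕ.+ p ℕ.* j)         ≡⟨ ^-+ γ (q ℕ.* i) (p ℕ.* j) ⟩
    γ ^ (q ℕ.* i) * γ ^ (p ℕ.* j)     ≡⟨ cong₂ _*_ (^-* γ q i) (^-* γ p j) ⟩
    (γ ^ q) ^ i * (γ ^ p) ^ j         ≡⟨ cong₂ _*_ u≡γ^qi v≡γ^pj ⟨
    u * v                             ∎)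

  power-split : ∀ {u v} γ e p q .{{_ : NonZero p}} .{{_ : NonZero q}} →
                u ^ p ≡ 1# → v ^ q ≡ 1# → γ ^ e ≡ u * v →
                ∀ s → (γ ^ s) ^ e ≡ u ^ (s % p) * v ^ (s % q)
  power-split {u} {v} γ e p q uᵖ≡1 v^q≡1 γᵉ≡uv s = begin
    (γ ^ s) ^ e                  ≡⟨ ^-swap γ s e ⟩
    (γ ^ e) ^ s                  ≡⟨ cong (_^ s) γᵉ≡uv ⟩
    (u * v) ^ s                  ≡⟨ *-^ u v s ⟩
    u ^ s * v ^ s                ≡⟨ cong₂ _*_ (^-mod u p s uᵖ≡1) (^-mod v q s v^q≡1) ⟩
    u ^ (s % p) * v ^ (s % q)    ∎

  zval-cross : ∀ {a b c d} → a ≢ 1# → b ≢ 0# → c ≢ 1# → d ≢ 0# → zval a b ≡ zval c d →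
               (a + b) * (c * d + d) ≡ (c + d) * (a * b + b)
  zval-cross {a} {b} {c} {d} a≢1 b≢0 c≢1 d≢0 =
    cross-multiply (denominator≢0 a≢1 b≢0) (denominator≢0 c≢1 d≢0)
    where
    denominator≢0 : ∀ {x y} → x ≢ 1# → y ≢ 0# → x * y + y ≢ 0#
    denominator≢0 {x} {y} x≢1 y≢0 xy+y≡0 = *-≢0 (≢⇒+≢0 x≢1) y≢0
      (trans (solve 2 (λ x y → (x :+ con 1) :* y := x :* y :+ y) refl x y) xy+y≡0)

  trinomial : (c₀ c₁ c₂ X Y : Carrier) → Carrier
  trinomial c₀ c₁ c₂ X Y = c₀ + (c₁ * X + c₂ * Y)

  Λ : (a b c d : Carrier) → Carrier → Carrier → Carrier
  Λ a b c d = trinomial (b * c + a * d) (c + d) (a + b)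

  Λ-first : ∀ a b c d → Λ a b c d a c ≡ 0#
  Λ-first a b c d = mod-two (b * c + a * d + a * c) (solve 4
    (λ a b c d → (b :* c :+ a :* d) :+ ((c :+ d) :* a :+ (a :+ b) :* c)
              := con 0 :+ (b :* c :+ a :* d :+ a :* c) :* (con 1 :+ con 1)) refl a b c d)

  Λ-second : ∀ a b c d → Λ a b c d b d ≡ 0#
  Λ-second a b c d = mod-two (b * c + a * d + b * d) (solve 4
    (λ a b c d → (b :* c :+ a :* d) :+ ((c :+ d) :* b :+ (a :+ b) :* d)
              := con 0 :+ (b :* c :+ a :* d :+ b :* d) :* (con 1 :+ con 1)) refl a b c d)

  Λ-products : ∀ {a b c d} → (a + b) * (c * d + d) ≡ (c + d) * (a * b + b) →
               Λ a b c d (a * b) (c * d) ≡ 0#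
  Λ-products {a} {b} {c} {d} cross = begin
    Λ a b c d (a * b) (c * d)                      ≡⟨ mod-two (b * d) (solve 4
      (λ a b c d → (a :+ b) :* (c :* d :+ d) :+ (c :+ d) :* (a :* b :+ b)
                := ((b :* c :+ a :* d) :+ ((c :+ d) :* (a :* b) :+ (a :+ b) :* (c :* d)))
                   :+ (b :* d) :* (con 1 :+ con 1)) refl a b c d) ⟨
    (a + b) * (c * d + d) + (c + d) * (a * b + b)  ≡⟨ cong (_+ (c + d) * (a * b + b)) cross ⟩
    (c + d) * (a * b + b) + (c + d) * (a * b + b)  ≡⟨ x+x≡0 _ ⟩
    0#                                             ∎

  Λ-at-one : ∀ a b c d → Λ a b c d 1# 1# ≡ 0# → (a + 1#) * (d + 1#) ≡ (b + 1#) * (c + 1#)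
  Λ-at-one a b c d Λ≡0 = begin
    (a + 1#) * (d + 1#)                        ≡⟨ mod-two (b * c + b + c) (solve 4
      (λ a b c d → ((b :* c :+ a :* d) :+ ((c :+ d) :* con 1 :+ (a :+ b) :* con 1)) :+ (b :+ con 1) :* (c :+ con 1)
                := (a :+ con 1) :* (d :+ con 1) :+ (b :* c :+ b :+ c) :* (con 1 :+ con 1)) refl a b c d) ⟨
    Λ a b c d 1# 1# + (b + 1#) * (c + 1#)      ≡⟨ cong (_+ (b + 1#) * (c + 1#)) Λ≡0 ⟩
    0# + (b + 1#) * (c + 1#)                   ≡⟨ +-identityˡ _ ⟩
    (b + 1#) * (c + 1#)                        ∎

  -- Writing A = a + 1, …, D = d + 1 the hypotheses read A D = B C and
  -- (A + B) C d = (C + D) A b; multiplying the latter by B and substituting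
  -- gives A D (A + B) d = A D (A + B) b, whence d = b and then a = c.
  pairs-coincide : ∀ {a b c d} → a ≢ 1# → b ≢ 1# → d ≢ 1# → a ≢ b →
                   (a + b) * (c * d + d) ≡ (c + d) * (a * b + b) →
                   Λ a b c d 1# 1# ≡ 0# → a ≡ c × b ≡ d
  pairs-coincide {a} {b} {c} {d} a≢1 b≢1 d≢1 a≢b cross Λ≡0 = a≡c , sym d≡b
    where
    shifted : (a + 1#) * (d + 1#) ≡ (b + 1#) * (c + 1#)
    shifted = Λ-at-one a b c d Λ≡0

    P : Carrier
    P = (a + 1#) * (d + 1#) * (a + b)

    P≢0 : P ≢ 0#
    P≢0 = *-≢0 (*-≢0 (≢⇒+≢0 a≢1) (≢⇒+≢0 d≢1)) (≢⇒+≢0 a≢b)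

    B≢0 : b + 1# ≢ 0#
    B≢0 = ≢⇒+≢0 b≢1

    -- B (C + D) = D (A + B), using A D = B C and characteristic two
    B[c+d] : (b + 1#) * (c + d) ≡ (d + 1#) * (a + b)
    B[c+d] = begin
      (b + 1#) * (c + d)                           ≡⟨ mod-two (b + 1#) (solve 3
        (λ b c d → (b :+ con 1) :* (c :+ con 1) :+ (b :+ con 1) :* (d :+ con 1)
                  := (b :+ con 1) :* (c :+ d) :+ (b :+ con 1) :* (con 1 :+ con 1)) refl b c d) ⟨
      (b + 1#) * (c + 1#) + (b + 1#) * (d + 1#)    ≡⟨ cong (_+ (b + 1#) * (d + 1#)) shifted ⟨
      (a + 1#) * (d + 1#) + (b + 1#) * (d + 1#)    ≡⟨ mod-two (d + 1#) (solve 3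
        (λ a b d → (a :+ con 1) :* (d :+ con 1) :+ (b :+ con 1) :* (d :+ con 1)
                  := (d :+ con 1) :* (a :+ b) :+ (d :+ con 1) :* (con 1 :+ con 1)) refl a b d) ⟩
      (d + 1#) * (a + b)                           ∎

    d≡b : d ≡ b
    d≡b = *-cancelˡ P≢0 (begin
      P * d                                   ≡⟨ solve 3 (λ a b d → (a :+ con 1) :* (d :+ con 1) :* (a :+ b) :* d
                                                                 := (a :+ b) :* ((a :+ con 1) :* (d :+ con 1)) :* d) refl a b d ⟩
      (a + b) * ((a + 1#) * (d + 1#)) * d     ≡⟨ cong (λ u → (a + b) * u * d) shifted ⟩
      (a + b) * ((b + 1#) * (c + 1#)) * d     ≡⟨ solve 4 (λ a b c d → (a :+ b) :* ((b :+ con 1) :* (c :+ con 1)) :* d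
                                                                 := (b :+ con 1) :* ((a :+ b) :* (c :* d :+ d))) refl a b c d ⟩
      (b + 1#) * ((a + b) * (c * d + d))      ≡⟨ cong ((b + 1#) *_) cross ⟩
      (b + 1#) * ((c + d) * (a * b + b))      ≡⟨ solve 4 (λ a b c d → (b :+ con 1) :* ((c :+ d) :* (a :* b :+ b))
                                                                 := ((b :+ con 1) :* (c :+ d)) :* (a :+ con 1) :* b) refl a b c d ⟩
      ((b + 1#) * (c + d)) * (a + 1#) * b     ≡⟨ cong (λ u → u * (a + 1#) * b) B[c+d] ⟩
      ((d + 1#) * (a + b)) * (a + 1#) * b     ≡⟨ solve 3 (λ a b d → (d :+ con 1) :* (a :+ b) :* (a :+ con 1) :* b
                                                                 := (a :+ con 1) :* (d :+ con 1) :* (a :+ b) :* b) refl a b d ⟩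
      P * b                                   ∎)

    a≡c : a ≡ c
    a≡c = ∙-cancelʳ 1# a c (*-cancelˡ B≢0 (begin
      (b + 1#) * (a + 1#)    ≡⟨ *-comm _ _ ⟩
      (a + 1#) * (b + 1#)    ≡⟨ cong (λ u → (a + 1#) * (u + 1#)) d≡b ⟨
      (a + 1#) * (d + 1#)    ≡⟨ shifted ⟩
      (b + 1#) * (c + 1#)    ∎))

  decoding-from-relation : ∀ p q .{{_ : NonZero p}} .{{_ : NonZero q}} γ (c₀ c₁ c₂ : Carrier) (e₁ e₂ : ℕ) →
                           trinomial c₀ c₁ c₂ 1# 1# ≢ 0# →
                           (∀ s → InCanonicalSet p q s →
                                  trinomial c₀ c₁ c₂ ((γ ^ s) ^ e₁) ((γ ^ s) ^ e₂) ≡ 0#) →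
                           InM₂ p q γ
  decoding-from-relation p q γ c₀ c₁ c₂ e₁ e₂ at-one≢0 vanishes =
    decoder , (λ s _ s∈S → trans (eval-decoder (γ ^ s)) (trans (cong (σ *_) (vanishes s s∈S)) (zeroʳ σ)))
            , (begin
      eval decoder 1#                              ≡⟨ eval-decoder 1# ⟩
      σ * trinomial c₀ c₁ c₂ (1# ^ e₁) (1# ^ e₂)   ≡⟨ cong₂ (λ X Y → σ * trinomial c₀ c₁ c₂ X Y) (1^ e₁) (1^ e₂) ⟩
      σ * trinomial c₀ c₁ c₂ 1# 1#                 ≡⟨ *-comm _ _ ⟩
      trinomial c₀ c₁ c₂ 1# 1# * σ                 ≡⟨ ⁻¹-inverse _ at-one≢0 ⟩
      1#                                           ∎)
    where
    σ : Carrier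
    σ = trinomial c₀ c₁ c₂ 1# 1# ⁻¹
    decoder : Poly3
    decoder = (σ * c₀ , 0) ∷ (σ * c₁ , e₁) ∷ (σ * c₂ , e₂) ∷ []
    eval-decoder : ∀ x → eval decoder x ≡ σ * trinomial c₀ c₁ c₂ (x ^ e₁) (x ^ e₂)
    eval-decoder x = solve 6
      (λ σ c₀ c₁ c₂ X Y → σ :* c₀ :* con 1 :+ (σ :* c₁ :* X :+ (σ :* c₂ :* Y :+ con 0))
                       := σ :* (c₀ :+ (c₁ :* X :+ c₂ :* Y))) refl σ c₀ c₁ c₂ (x ^ e₁) (x ^ e₂)

  -- For s ∈ S_m with residues (σ₁, σ₂) modulo (p, q), the monomial with
  -- γ^e = u v takes the value u^σ₁ v^σ₂ at γ^s, i.e. u v, v or u.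
  select : ∀ {p q s} .{{_ : NonZero p}} .{{_ : NonZero q}} →
           InCanonicalSet p q s → Carrier → Carrier → Carrier
  select (inj₁ _)        u v = u * v
  select (inj₂ (inj₁ _)) u v = v
  select (inj₂ (inj₂ _)) u v = u

  canonical-power : ∀ {u v p q s} .{{_ : NonZero p}} .{{_ : NonZero q}} γ e → 1 ℕ.< p → 1 ℕ.< q →
                    u ^ p ≡ 1# → v ^ q ≡ 1# → γ ^ e ≡ u * v →
                    (s∈S : InCanonicalSet p q s) → (γ ^ s) ^ e ≡ select s∈S u v
  canonical-power {u} {v} {p} {q} {s} γ e 1<p 1<q uᵖ≡1 v^q≡1 γᵉ≡uv s∈S =
    trans (power-split γ e p q uᵖ≡1 v^q≡1 γᵉ≡uv s) (by-class s∈S)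
    where
    ^-unit : ∀ x {k n} .{{_ : NonZero n}} → 1 ℕ.< n → k ≡ 1 % n → x ^ k ≡ x
    ^-unit x 1<n k≡1%n rewrite k≡1%n | ℕD.m<n⇒m%n≡m 1<n = *-identityʳ x
    ^-zero : ∀ x {k} → k ≡ 0 → x ^ k ≡ 1#
    ^-zero x refl = refl
    by-class : (s∈S : InCanonicalSet p q s) → u ^ (s % p) * v ^ (s % q) ≡ select s∈S u v
    by-class (inj₁ (s≡1 , s≡1′))       = cong₂ _*_ (^-unit u 1<p s≡1) (^-unit v 1<q s≡1′)
    by-class (inj₂ (inj₁ (s≡0 , s≡1))) = trans (cong₂ _*_ (^-zero u s≡0) (^-unit v 1<q s≡1)) (*-identityˡ v)
    by-class (inj₂ (inj₂ (s≡1 , s≡0))) = trans (cong₂ _*_ (^-unit u 1<p s≡1) (^-zero v s≡0)) (*-identityʳ u)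

  Λ-at-selected : ∀ {a b c d p q s} .{{_ : NonZero p}} .{{_ : NonZero q}} →
                  (a + b) * (c * d + d) ≡ (c + d) * (a * b + b) →
                  (s∈S : InCanonicalSet p q s) → Λ a b c d (select s∈S a b) (select s∈S c d) ≡ 0#
  Λ-at-selected cross (inj₁ _)        = Λ-products cross
  Λ-at-selected cross (inj₂ (inj₁ _)) = Λ-second _ _ _ _
  Λ-at-selected cross (inj₂ (inj₂ _)) = Λ-first _ _ _ _

open FieldTheory using (Λ; zval-cross; order-≢1; order-excludes-prime; exponent-of-product;
                        pairs-coincide; canonical-power; Λ-at-selected; decoding-from-relation)

proposition3p4 : (p q : ℕ) → {{_ : NonZero p}} → {{_ : NonZero q}} →
                 Prime p → Prime q → p % 2 ≡ 1 → q % 2 ≡ 1 → p ≢ q →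
                 (t : ℕ) → IsOrderMod 2 (p ℕ.* q) t →
                 (F : FiniteField t) → (γ : FiniteField.Carrier F) →
                 FiniteField.HasOrder F γ (p ℕ.* q) →
                 FiniteField.ZHasRepeat F p q →
                 FiniteField.InM₂ F p q γ
proposition3p4 p q p-prime q-prime p-odd q-odd p≢q t _ F γ γ-order
  ((z₁ , z₂) , (w₁ , w₂) , (_ , z₂≢0 , z₁-order , z₂-order) , (_ , w₂≢0 , w₁-order , w₂-order) ,
   pairs≢ , zvals≡) =
  decode (exponent-of-product F p q γ-order p-odd q-odd (root z₁-order) (root z₂-order))
         (exponent-of-product F p q γ-order p-odd q-odd (root w₁-order) (root w₂-order))
  where
  open FiniteField F using (_+_; _*_; _^_; 0#; 1#; HasOrder; InCanonicalSet; InM₂)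
  root : ∀ {u n} → HasOrder u n → u ^ n ≡ 1#
  root = proj₁ ∘ proj₂
  1<p : 1 ℕ.< p
  1<p = ℕ.nonTrivial⇒n>1 p {{prime⇒nonTrivial p-prime}}
  1<q : 1 ℕ.< q
  1<q = ℕ.nonTrivial⇒n>1 q {{prime⇒nonTrivial q-prime}}

  cross : (z₁ + z₂) * (w₁ * w₂ + w₂) ≡ (w₁ + w₂) * (z₁ * z₂ + z₂)
  cross = zval-cross F (order-≢1 F z₁-order 1<p) z₂≢0 (order-≢1 F w₁-order 1<p) w₂≢0 zvals≡

  z₁≢z₂ : z₁ ≢ z₂
  z₁≢z₂ z₁≡z₂ = order-excludes-prime F z₁-order 1<p q-prime p≢q
                  (subst (λ z → z ^ q ≡ 1#) (sym z₁≡z₂) (root z₂-order))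
  at-one≢0 : Λ F z₁ z₂ w₁ w₂ 1# 1# ≢ 0#
  at-one≢0 Λ≡0 = pairs≢ (uncurry (cong₂ _,_)
    (pairs-coincide F {z₁} {z₂} {w₁} {w₂} (order-≢1 F z₁-order 1<p) (order-≢1 F z₂-order 1<q)
                      (order-≢1 F w₂-order 1<q) z₁≢z₂ cross Λ≡0))

  decode : (∃ λ e → γ ^ e ≡ z₁ * z₂) → (∃ λ e → γ ^ e ≡ w₁ * w₂) → InM₂ p q γ
  decode (e₁ , γ^e₁) (e₂ , γ^e₂) =
    decoding-from-relation F p q γ (z₂ * w₁ + z₁ * w₂) (w₁ + w₂) (z₁ + z₂) e₁ e₂ at-one≢0 λ s s∈S →
      trans (cong₂ (Λ F z₁ z₂ w₁ w₂) (canonical-power F γ e₁ 1<p 1<q (root z₁-order) (root z₂-order) γ^e₁ s∈S)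
                                     (canonical-power F γ e₂ 1<p 1<q (root w₁-order) (root w₂-order) γ^e₂ s∈S))
            (Λ-at-selected F cross s∈S)
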